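{- Consider an FSC instance with exactly two groups $g_1,g_2$ satisfying the standing assumptions below. Run the following algorithm: set $X=\emptyset$ and $U^-=U$; while $U^-\neq\emptyset$, choose, among sets not yet in $X$, a pair $(S_A,S_B)$ with $g(S_A)=g_1$, $g(S_B)=g_2$ maximizing $|U^-\cap(S_A\cup S_B)|$, add $S_A,S_B$ to $X$, and set $U^-\gets U^-\setminus(S_A\cup S_B)$; return $X$. Then $|X|\le(\ln n+1)\,|X^*|$, where $X^*$ is a minimum-cardinality fair cover.
   Context: An FSC instance consists of a universe $U$ of $n$ elements, a family $\mathcal{S}$ of subsets of $U$ with union $U$, and groups (colors); each set $S$ belongs to exactly one group $g(S)$. Let $\mathcal{S}_h$ be the sets of group $g_h$. A cover is a subfamily of $\mathcal{S}$ whose union is $U$; with $k$ groups, a cover $X$ is fair if $|X\cap\mathcal{S}_h|=|X|/k$ for all $h$. $X^*$ denotes a fair cover of minimum cardinality. Standing assumptions: every group contains the same number $m$ of sets, and every group contains at least $\Omega(\log n)\cdot\frac{|X^*|}{k}$ sets. -}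

module Defs where

open import Data.Nat using (ℕ; zero; suc; _^_; _*_; _∸_; _!)
import Data.Nat as ℕ
open import Data.Nat.Properties using (_!≢0)
open import Data.Integer using (+_)
open import Data.Rational using (ℚ; 1ℚ)
import Data.Rational as ℚ
open import Data.Fin using (Fin; zero; suc)
import Data.Fin as Fin
open import Data.Fin.Subset using (Subset; _∈_; _∉_; _∩_; _∪_; _─_; ⁅_⁆; ∣_∣; Nonempty; Empty)
open import Data.Vec using (tabulate)
open import Data.Product using (∃; _×_)
open import Relation.Nullary.Decidable using (⌊_⌋)
open import Relation.Binary.PropositionalEquality using (_≡_)

-- Real-number bound without reals.
-- expPartial a k = Σ_{j=0}^{k} a^j / j!  (partial sums of the exponential
-- series, in ℚ).  Since these increase to e^a,
--   ExpLe a N  ⇔  e^a ≤ N   (as real numbers).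

expTerm : ℕ → ℕ → ℚ
expTerm a j = ℚ._/_ (+ (a ^ j)) (j !) {{j !≢0}}

expPartial : ℕ → ℕ → ℚ
expPartial a zero    = 1ℚ
expPartial a (suc k) = expPartial a k ℚ.+ expTerm a (suc k)

ExpLe : ℕ → ℕ → Set
ExpLe a N = ∀ k → expPartial a k ℚ.≤ ℚ._/_ (+ N) 1

LnBound : ℕ → ℕ → ℕ → Set
LnBound x y n = ExpLe (x ∸ y) (n ^ y)

-- FSC instances.
-- Universe U = Fin n; the family of sets is indexed by Fin s,
-- S i : Subset n is the i-th set, col i : Fin k is its group.
-- A subfamily is a Subset s (a set of indices).

group : ∀ {s k} → (Fin s → Fin k) → Fin k → Subset s
group col h = tabulate (λ i → ⌊ col i Fin.≟ h ⌋)

FamilyCoversU : ∀ {n s} → (Fin s → Subset n) → Set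
FamilyCoversU {n} {s} S = ∀ (u : Fin n) → ∃ λ (i : Fin s) → u ∈ S i

IsCover : ∀ {n s} → (Fin s → Subset n) → Subset s → Set
IsCover {n} {s} S X = ∀ (u : Fin n) → ∃ λ (i : Fin s) → (i ∈ X) × (u ∈ S i)

-- X is fair: |X ∩ S_h| = |X| / k for every group h  (stated as k·|X ∩ S_h| = |X|)
IsFair : ∀ {s k} → (Fin s → Fin k) → Subset s → Set
IsFair {s} {k} col X = ∀ (h : Fin k) → k * ∣ X ∩ group col h ∣ ≡ ∣ X ∣

IsMinFairCover : ∀ {n s k} → (Fin s → Subset n) → (Fin s → Fin k) → Subset s → Set
IsMinFairCover {n} {s} {k} S col X =
  IsCover S X × IsFair col X ×
  (∀ (Y : Subset s) → IsCover S Y → IsFair col Y → ∣ X ∣ ℕ.≤ ∣ Y ∣)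

EqualGroupSizes : ∀ {s k} → (Fin s → Fin k) → Set
EqualGroupSizes {s} {k} col = ∀ (h h' : Fin k) → ∣ group col h ∣ ≡ ∣ group col h' ∣

-- GreedyRun S col X U⁻ X' : starting from the state (X, U⁻), some
-- execution of the while-loop (with arbitrary tie-breaking) terminates
-- and returns X'.

g₁ g₂ : Fin 2
g₁ = zero
g₂ = suc zero

data GreedyRun {n s : ℕ} (S : Fin s → Subset n) (col : Fin s → Fin 2)
       : Subset s → Subset n → Subset s → Set where
  done : ∀ {X U⁻} → Empty U⁻ → GreedyRun S col X U⁻ X
  step : ∀ {X U⁻ X'} (a b : Fin s) →
         Nonempty U⁻ →
         a ∉ X → b ∉ X → col a ≡ g₁ → col b ≡ g₂ →
         (∀ (a' b' : Fin s) → a' ∉ X → b' ∉ X → col a' ≡ g₁ → col b' ≡ g₂ →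
            ∣ U⁻ ∩ (S a' ∪ S b') ∣ ℕ.≤ ∣ U⁻ ∩ (S a ∪ S b) ∣) →
         GreedyRun S col ((X ∪ ⁅ a ⁆) ∪ ⁅ b ⁆) (U⁻ ─ (S a ∪ S b)) X' →
         GreedyRun S col X U⁻ X'

module Submission where

-- Let p = ∣X*∣ / 2 be the number of sets of each colour in X*.  Every uncovered element lies
-- in the union of at least p of the p² two-coloured pairs of sets of X*, so one of these pairs
-- covers at least ∣U⁻∣ / p uncovered elements, and by maximality so does the greedy pair (a
-- member of a pair that is already chosen covers nothing new and may be swapped for the greedy
-- set of its colour).  Hence every round leaves at most (1 − 1/p) ∣U⁻∣, and a run of t + 1
-- rounds has (p / (p − 1))^t ≤ n.  Finally e^a ≤ (1 − 1/p)^(−pa), termwise on the partial sums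
-- of the exponential and negative binomial series, gives e^(∣X∣ − ∣X*∣) ≤ e^(2t) ≤ n^(2p).

open import Data.Bool.Base using (Bool; true; false)
open import Data.Fin using (Fin; zero; suc)
import Data.Fin as Fin
open import Data.Fin.Subset using (Subset; _∈_; _∉_; _⊆_; _∩_; _∪_; _─_; ⁅_⁆; ∣_∣; ⊥; ⊤; inside; outside)
open import Data.Fin.Subset.Properties
  using ( _∈?_; ∉⊥; drop-not-there; x∈⁅y⁆⇒x≡y; x∈p∩q⁺; x∈p∩q⁻; x∈p∪q⁺; x∈p∪q⁻; p─q⊆p; ∩-zeroˡ; ∪-identityʳ
        ; p⊆q⇒∣p∣≤∣q∣; x∈p⇒∣p-x∣<∣p∣; ∣⊥∣≡0; ∣⊤∣≡n)
import Data.Integer.Base as ℤ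
import Data.Integer.Properties as ℤ
open import Data.Nat.Base using (ℕ; zero; suc; _+_; _*_; _∸_; _^_; _≤_; _⊓_; _!; NonZero; z≤n; s≤s)
open import Data.Nat.Properties
open import Data.Nat.Tactic.RingSolver using (solve-∀)
open import Data.Product using (_×_; _,_; ∃; proj₂)
open import Data.Rational.Base using (toℚᵘ)
import Data.Rational.Base as ℚ
open import Data.Rational.Properties using (toℚᵘ-fromℚᵘ; toℚᵘ-homo-+; toℚᵘ-cancel-≤)
open import Data.Rational.Unnormalised.Base using (mkℚᵘ; *≡*; *≤*)
  renaming (_/_ to _/ᵘ_; _≃_ to _≃ᵘ_; _≤_ to _≤ᵘ_; _+_ to _+ᵘ_)
import Data.Rational.Unnormalised.Properties as ℚᵘ
open import Data.Sum using (_⊎_; inj₁; inj₂)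
open import Data.Unit using (tt)
import Data.Unit as Unit
open import Data.Vec.Base using ([]; _∷_; lookup; here; there)
open import Data.Vec.Properties using ([]=⇒lookup; lookup⇒[]=; lookup∘tabulate)
open import Relation.Binary.PropositionalEquality
open import Relation.Nullary using (yes; no; does; contradiction)
open import Relation.Nullary.Decidable using (isYes; isYes≗does; dec-true)

open import Algebra.Properties.Semiring.Sum +-*-semiring
  using (sum-syntax; sum-cong-≗; ∑-comm; *-distribˡ-sum; *-distribʳ-sum)

open import Defs

𝟙 : Bool → ℕ
𝟙 true  = 1
𝟙 false = 0

∑-mono-≤ : ∀ {n} {f g : Fin n → ℕ} → (∀ i → f i ≤ g i) → ∑[ i < n ] f i ≤ ∑[ i < n ] g i
∑-mono-≤ {zero}  f≤g = z≤n
∑-mono-≤ {suc n} f≤g = +-mono-≤ (f≤g zero) (∑-mono-≤ (λ i → f≤g (suc i)))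

term≤∑ : ∀ {n} (f : Fin n → ℕ) i → f i ≤ ∑[ j < n ] f j
term≤∑ f zero    = m≤m+n _ _
term≤∑ f (suc i) = ≤-trans (term≤∑ (λ j → f (suc j)) i) (m≤n+m _ _)

∣p∣≡∑𝟙 : ∀ {n} (p : Subset n) → ∣ p ∣ ≡ ∑[ i < n ] 𝟙 (lookup p i)
∣p∣≡∑𝟙 []            = refl
∣p∣≡∑𝟙 (inside  ∷ p) = cong suc (∣p∣≡∑𝟙 p)
∣p∣≡∑𝟙 (outside ∷ p) = ∣p∣≡∑𝟙 p

𝟙-∈ : ∀ {n} {x : Fin n} {p} → x ∈ p → 𝟙 (lookup p x) ≡ 1
𝟙-∈ x∈p rewrite []=⇒lookup x∈p = refl

𝟙-guard : ∀ b {x y} → (b ≡ true → x ≤ y) → 𝟙 b * x ≤ 𝟙 b * y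
𝟙-guard true  x≤y = *-monoʳ-≤ 1 (x≤y refl)
𝟙-guard false _   = z≤n

∣p─q∣+∣p∩q∣≡∣p∣ : ∀ {n} (p q : Subset n) → ∣ p ─ q ∣ + ∣ p ∩ q ∣ ≡ ∣ p ∣
∣p─q∣+∣p∩q∣≡∣p∣ []            []            = refl
∣p─q∣+∣p∩q∣≡∣p∣ (inside  ∷ p) (inside  ∷ q) = trans (+-suc _ _) (cong suc (∣p─q∣+∣p∩q∣≡∣p∣ p q))
∣p─q∣+∣p∩q∣≡∣p∣ (inside  ∷ p) (outside ∷ q) = cong suc (∣p─q∣+∣p∩q∣≡∣p∣ p q)
∣p─q∣+∣p∩q∣≡∣p∣ (outside ∷ p) (inside  ∷ q) = ∣p─q∣+∣p∩q∣≡∣p∣ p q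
∣p─q∣+∣p∩q∣≡∣p∣ (outside ∷ p) (outside ∷ q) = ∣p─q∣+∣p∩q∣≡∣p∣ p q

x∉p⇒∣p∪⁅x⁆∣≡1+∣p∣ : ∀ {n} {x : Fin n} {p} → x ∉ p → ∣ p ∪ ⁅ x ⁆ ∣ ≡ suc ∣ p ∣
x∉p⇒∣p∪⁅x⁆∣≡1+∣p∣ {x = zero}  {inside  ∷ p} x∉p = contradiction here x∉p
x∉p⇒∣p∪⁅x⁆∣≡1+∣p∣ {x = zero}  {outside ∷ p} x∉p = cong (λ q → suc ∣ q ∣) (∪-identityʳ p)
x∉p⇒∣p∪⁅x⁆∣≡1+∣p∣ {x = suc x} {inside  ∷ p} x∉p = cong suc (x∉p⇒∣p∪⁅x⁆∣≡1+∣p∣ (drop-not-there x∉p))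
x∉p⇒∣p∪⁅x⁆∣≡1+∣p∣ {x = suc x} {outside ∷ p} x∉p = x∉p⇒∣p∪⁅x⁆∣≡1+∣p∣ (drop-not-there x∉p)

module _ {n s : ℕ} (T : Fin s → Subset n) (F G : Subset s) (U : Subset n) where

  incidence : Fin s → Fin s → Fin n → ℕ
  incidence A B u = 𝟙 (lookup F A) * (𝟙 (lookup G B) * 𝟙 (lookup (U ∩ (T A ∪ T B)) u))

  ∑-incidence : ∀ A B → ∑[ u < n ] incidence A B u ≡ 𝟙 (lookup F A) * (𝟙 (lookup G B) * ∣ U ∩ (T A ∪ T B) ∣)
  ∑-incidence A B = begin
    ∑[ u < n ] incidence A B u      ≡⟨ *-distribˡ-sum f (λ u → g * e u) ⟨
    f * ∑[ u < n ] (g * e u)        ≡⟨ cong (f *_) (*-distribˡ-sum g e) ⟨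
    f * (g * ∑[ u < n ] e u)        ≡⟨ cong (λ x → f * (g * x)) (∣p∣≡∑𝟙 (U ∩ (T A ∪ T B))) ⟨
    f * (g * ∣ U ∩ (T A ∪ T B) ∣)   ∎
    where
    open ≡-Reasoning
    f = 𝟙 (lookup F A)
    g = 𝟙 (lookup G B)
    e : Fin n → ℕ
    e u = 𝟙 (lookup (U ∩ (T A ∪ T B)) u)

  incidence-viaˡ : ∀ {C u} → C ∈ F → u ∈ U → u ∈ T C → ∀ B → incidence C B u ≡ 𝟙 (lookup G B)
  incidence-viaˡ {C} {u} C∈F u∈U u∈TC B
    rewrite 𝟙-∈ C∈F | 𝟙-∈ (x∈p∩q⁺ (u∈U , x∈p∪q⁺ {p = T C} {T B} (inj₁ u∈TC))) =
    trans (+-identityʳ _) (*-identityʳ (𝟙 (lookup G B)))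

  incidence-viaʳ : ∀ {C u} → C ∈ G → u ∈ U → u ∈ T C → ∀ A → incidence A C u ≡ 𝟙 (lookup F A)
  incidence-viaʳ {C} {u} C∈G u∈U u∈TC A
    rewrite 𝟙-∈ C∈G | 𝟙-∈ (x∈p∩q⁺ (u∈U , x∈p∪q⁺ {p = T A} {T C} (inj₂ u∈TC))) =
    *-identityʳ (𝟙 (lookup F A))

  incidences-at : (∀ {u} → u ∈ U → ∃ λ C → (C ∈ F ⊎ C ∈ G) × u ∈ T C) →
                  ∀ u → 𝟙 (lookup U u) * (∣ F ∣ ⊓ ∣ G ∣) ≤ ∑[ A < s ] ∑[ B < s ] incidence A B u
  incidences-at covered u with lookup U u in U[u]
  ... | false = z≤n
  ... | true with covered (lookup⇒[]= u U U[u])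
  ...   | C , inj₁ C∈F , u∈TC = begin
    1 * (∣ F ∣ ⊓ ∣ G ∣)                      ≡⟨ *-identityˡ _ ⟩
    ∣ F ∣ ⊓ ∣ G ∣                            ≤⟨ m⊓n≤n ∣ F ∣ ∣ G ∣ ⟩
    ∣ G ∣                                    ≡⟨ ∣p∣≡∑𝟙 G ⟩
    ∑[ B < s ] 𝟙 (lookup G B)                ≡⟨ sum-cong-≗ (incidence-viaˡ C∈F (lookup⇒[]= u U U[u]) u∈TC) ⟨
    ∑[ B < s ] incidence C B u               ≤⟨ term≤∑ (λ A → ∑[ B < s ] incidence A B u) C ⟩
    ∑[ A < s ] ∑[ B < s ] incidence A B u    ∎
    where open ≤-Reasoning
  ...   | C , inj₂ C∈G , u∈TC = begin
    1 * (∣ F ∣ ⊓ ∣ G ∣)                      ≡⟨ *-identityˡ _ ⟩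
    ∣ F ∣ ⊓ ∣ G ∣                            ≤⟨ m⊓n≤m ∣ F ∣ ∣ G ∣ ⟩
    ∣ F ∣                                    ≡⟨ ∣p∣≡∑𝟙 F ⟩
    ∑[ A < s ] 𝟙 (lookup F A)                ≡⟨ sum-cong-≗ (incidence-viaʳ C∈G (lookup⇒[]= u U U[u]) u∈TC) ⟨
    ∑[ A < s ] incidence A C u               ≤⟨ ∑-mono-≤ (λ A → term≤∑ (λ B → incidence A B u) C) ⟩
    ∑[ A < s ] ∑[ B < s ] incidence A B u    ∎
    where open ≤-Reasoning

  -- Double counting: every element of U lies in at least ∣ F ∣ ⊓ ∣ G ∣ of the unions T A ∪ T B
  -- with A ∈ F and B ∈ G.
  pair-averaging : ∀ c →
    (∀ {u} → u ∈ U → ∃ λ C → (C ∈ F ⊎ C ∈ G) × u ∈ T C) →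
    (∀ {A B} → A ∈ F → B ∈ G → ∣ U ∩ (T A ∪ T B) ∣ ≤ c) →
    ∣ U ∣ * (∣ F ∣ ⊓ ∣ G ∣) ≤ ∣ F ∣ * (∣ G ∣ * c)
  pair-averaging c covered bounded = begin
    ∣ U ∣ * r                                           ≡⟨ cong (_* r) (∣p∣≡∑𝟙 U) ⟩
    ∑[ u < n ] 𝟙U u * r                                 ≡⟨ *-distribʳ-sum r 𝟙U ⟩
    ∑[ u < n ] (𝟙U u * r)                               ≤⟨ ∑-mono-≤ (incidences-at covered) ⟩
    ∑[ u < n ] ∑[ A < s ] ∑[ B < s ] incidence A B u    ≡⟨ ∑-comm (λ u A → ∑[ B < s ] incidence A B u) ⟩
    ∑[ A < s ] ∑[ u < n ] ∑[ B < s ] incidence A B u    ≡⟨ sum-cong-≗ (λ A → ∑-comm (λ u B → incidence A B u)) ⟩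
    ∑[ A < s ] ∑[ B < s ] ∑[ u < n ] incidence A B u    ≡⟨ sum-cong-≗ (λ A → sum-cong-≗ (∑-incidence A)) ⟩
    ∑[ A < s ] ∑[ B < s ] (𝟙F A * (𝟙G B * ∣ U ∩ (T A ∪ T B) ∣))
      ≤⟨ ∑-mono-≤ (λ A → ∑-mono-≤ (λ B →
           𝟙-guard (lookup F A) (λ F[A] → 𝟙-guard (lookup G B) (λ G[B] →
             bounded (lookup⇒[]= A F F[A]) (lookup⇒[]= B G G[B]))))) ⟩
    ∑[ A < s ] ∑[ B < s ] (𝟙F A * (𝟙G B * c))           ≡⟨ sum-cong-≗ (λ A → *-distribˡ-sum (𝟙F A) (λ B → 𝟙G B * c)) ⟨
    ∑[ A < s ] (𝟙F A * ∑[ B < s ] (𝟙G B * c))           ≡⟨ sum-cong-≗ (λ A → cong (𝟙F A *_) (*-distribʳ-sum c 𝟙G)) ⟨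
    ∑[ A < s ] (𝟙F A * (∑[ B < s ] 𝟙G B * c))           ≡⟨ *-distribʳ-sum (∑[ B < s ] 𝟙G B * c) 𝟙F ⟨
    ∑[ A < s ] 𝟙F A * (∑[ B < s ] 𝟙G B * c)             ≡⟨ cong₂ (λ x y → x * (y * c)) (∣p∣≡∑𝟙 F) (∣p∣≡∑𝟙 G) ⟨
    ∣ F ∣ * (∣ G ∣ * c)                                  ∎
    where
    open ≤-Reasoning
    r = ∣ F ∣ ⊓ ∣ G ∣
    𝟙U : Fin n → ℕ
    𝟙U u = 𝟙 (lookup U u)
    𝟙F 𝟙G : Fin s → ℕ
    𝟙F A = 𝟙 (lookup F A)
    𝟙G B = 𝟙 (lookup G B)

^-distribʳ-* : ∀ x y k → (x * y) ^ k ≡ x ^ k * y ^ k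
^-distribʳ-* x y zero    = refl
^-distribʳ-* x y (suc k) = begin
  x * y * (x * y) ^ k       ≡⟨ cong (x * y *_) (^-distribʳ-* x y k) ⟩
  x * y * (x ^ k * y ^ k)   ≡⟨ regroup x y (x ^ k) (y ^ k) ⟩
  x * x ^ k * (y * y ^ k)   ∎
  where
  open ≡-Reasoning
  regroup : ∀ x y u v → x * y * (u * v) ≡ x * u * (y * v)
  regroup = solve-∀

-- expNum a k = k! · expPartial a k
expNum : ℕ → ℕ → ℕ
expNum a zero    = 1
expNum a (suc k) = expNum a k * suc k + a ^ suc k

rising : ℕ → ℕ → ℕ
rising x zero    = 1
rising x (suc j) = rising x j * (x + j)

-- negBinNum p M k = k! p^k Σ_{j ≤ k} rising M j / (j! p^j), a partial sum of (1 − 1/p)^(−M).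
negBinNum : ℕ → ℕ → ℕ → ℕ
negBinNum p M zero    = 1
negBinNum p M (suc k) = suc k * p * negBinNum p M k + rising M (suc k)

rising-shift : ∀ M k → rising (suc M) k * M ≡ rising M k * (M + k)
rising-shift M zero    = cong (1 *_) (sym (+-identityʳ M))
rising-shift M (suc k) = begin
  rising (suc M) k * (suc M + k) * M   ≡⟨ regroup (rising (suc M) k) (suc M + k) M ⟩
  rising (suc M) k * M * (suc M + k)   ≡⟨ cong (_* (suc M + k)) (rising-shift M k) ⟩
  rising M k * (M + k) * (suc M + k)   ≡⟨ cong (rising M k * (M + k) *_) (sym (+-suc M k)) ⟩
  rising M k * (M + k) * (M + suc k)   ∎
  where
  open ≡-Reasoning
  regroup : ∀ x y z → x * y * z ≡ x * z * y
  regroup = solve-∀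

rising-pascal : ∀ M k → rising (suc M) (suc k) ≡ rising M (suc k) + suc k * rising (suc M) k
rising-pascal M k = begin
  rising (suc M) k * (suc M + k)                      ≡⟨ regroup (rising (suc M) k) M k ⟩
  rising (suc M) k * M + suc k * rising (suc M) k     ≡⟨ cong (_+ suc k * rising (suc M) k) (rising-shift M k) ⟩
  rising M k * (M + k) + suc k * rising (suc M) k     ∎
  where
  open ≡-Reasoning
  regroup : ∀ x M k → x * (suc M + k) ≡ x * M + suc k * x
  regroup = solve-∀

-- The partial-sum form of (1 − 1/p) · (1 − 1/p)^(−(M+1)) = (1 − 1/p)^(−M).
negBinNum-pascal : ∀ p M k → p * negBinNum p (suc M) k + rising (suc M) k ≡ p * negBinNum p M k + negBinNum p (suc M) k
negBinNum-pascal p M zero    = refl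
negBinNum-pascal p M (suc k) = begin
  p * (K * A + r′) + r′                ≡⟨ cong (λ z → p * (K * A + z) + r′) (rising-pascal M k) ⟩
  p * (K * A + (s′ + suc k * r)) + r′  ≡⟨ regroup p k A s′ r r′ ⟩
  K * (p * A + r) + p * s′ + r′        ≡⟨ cong (λ z → K * z + p * s′ + r′) (negBinNum-pascal p M k) ⟩
  K * (p * B + A) + p * s′ + r′        ≡⟨ regroup′ p k A B s′ r′ ⟩
  p * (K * B + s′) + (K * A + r′)      ∎
  where
  open ≡-Reasoning
  K = suc k * p
  A = negBinNum p (suc M) k
  B = negBinNum p M k
  r = rising (suc M) k
  r′ = rising (suc M) (suc k)
  s′ = rising M (suc k)
  regroup : ∀ p k A s r r′ → p * (suc k * p * A + (s + suc k * r)) + r′ ≡ suc k * p * (p * A + r) + p * s + r′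
  regroup = solve-∀
  regroup′ : ∀ p k A B s r′ → suc k * p * (p * B + A) + p * s + r′ ≡ p * (suc k * p * B + s) + (suc k * p * A + r′)
  regroup′ = solve-∀

negBinNum-step : ∀ m M k → m * negBinNum (suc m) (suc M) k ≤ suc m * negBinNum (suc m) M k
negBinNum-step m M k = +-cancelʳ-≤ A (m * A) (suc m * B) (begin
  m * A + A                       ≡⟨ +-comm (m * A) A ⟩
  suc m * A                       ≤⟨ m≤m+n (suc m * A) (rising (suc M) k) ⟩
  suc m * A + rising (suc M) k    ≡⟨ negBinNum-pascal (suc m) M k ⟩
  suc m * B + A                   ∎)
  where
  open ≤-Reasoning
  A = negBinNum (suc m) (suc M) k
  B = negBinNum (suc m) M k

rising-0 : ∀ k → rising 0 (suc k) ≡ 0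
rising-0 zero    = refl
rising-0 (suc k) rewrite rising-0 k = refl

negBinNum-0 : ∀ p k → negBinNum p 0 k ≡ k ! * p ^ k
negBinNum-0 p zero    = refl
negBinNum-0 p (suc k) rewrite rising-0 k | negBinNum-0 p k = regroup (suc k) p (k !) (p ^ k)
  where
  regroup : ∀ k p f q → k * p * (f * q) + 0 ≡ k * f * (p * q)
  regroup = solve-∀

negBinNum-bound : ∀ m M k → m ^ M * negBinNum (suc m) M k ≤ suc m ^ M * (k ! * suc m ^ k)
negBinNum-bound m zero    k = ≤-reflexive (cong (_+ 0) (negBinNum-0 (suc m) k))
negBinNum-bound m (suc M) k = begin
  m * m ^ M * negBinNum (suc m) (suc M) k     ≡⟨ regroup m (m ^ M) _ ⟩
  m ^ M * (m * negBinNum (suc m) (suc M) k)   ≤⟨ *-monoʳ-≤ (m ^ M) (negBinNum-step m M k) ⟩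
  m ^ M * (suc m * negBinNum (suc m) M k)     ≡⟨ regroup′ (m ^ M) (suc m) _ ⟩
  suc m * (m ^ M * negBinNum (suc m) M k)     ≤⟨ *-monoʳ-≤ (suc m) (negBinNum-bound m M k) ⟩
  suc m * (suc m ^ M * (k ! * suc m ^ k))     ≡⟨ *-assoc (suc m) (suc m ^ M) _ ⟨
  suc m * suc m ^ M * (k ! * suc m ^ k)       ∎
  where
  open ≤-Reasoning
  regroup : ∀ x y z → x * y * z ≡ y * (x * z)
  regroup = solve-∀
  regroup′ : ∀ x y z → x * (y * z) ≡ y * (x * z)
  regroup′ = solve-∀

^≤rising : ∀ x j → x ^ j ≤ rising x j
^≤rising x zero    = ≤-refl
^≤rising x (suc j) = begin
  x * x ^ j          ≡⟨ *-comm x (x ^ j) ⟩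
  x ^ j * x          ≤⟨ *-mono-≤ (^≤rising x j) (m≤m+n x j) ⟩
  rising x j * (x + j) ∎
  where open ≤-Reasoning

expNum≤negBinNum : ∀ p a k → expNum a k * p ^ k ≤ negBinNum p (p * a) k
expNum≤negBinNum p a zero    = ≤-refl
expNum≤negBinNum p a (suc k) = begin
  (expNum a k * suc k + a ^ suc k) * p ^ suc k              ≡⟨ regroup (expNum a k) (suc k) (a ^ suc k) p (p ^ k) ⟩
  suc k * p * (expNum a k * p ^ k) + p ^ suc k * a ^ suc k  ≡⟨ cong (suc k * p * (expNum a k * p ^ k) +_) (^-distribʳ-* p a (suc k)) ⟨
  suc k * p * (expNum a k * p ^ k) + (p * a) ^ suc k        ≤⟨ +-mono-≤ (*-monoʳ-≤ (suc k * p) (expNum≤negBinNum p a k)) (^≤rising (p * a) (suc k)) ⟩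
  suc k * p * negBinNum p (p * a) k + rising (p * a) (suc k) ∎
  where
  open ≤-Reasoning
  regroup : ∀ e k t p q → (e * k + t) * (p * q) ≡ k * p * (e * q) + p * q * t
  regroup = solve-∀

-- e^a ≤ (1 − 1/p)^(−pa) = (p/m)^(pa) for p = m + 1.
exp≤negBinomial : ∀ m a k → expNum a k * m ^ (suc m * a) ≤ suc m ^ (suc m * a) * k !
exp≤negBinomial m a k = *-cancelʳ-≤ _ _ (p ^ k) {{m^n≢0 p k}} (begin
  expNum a k * m ^ M * p ^ k        ≡⟨ regroup (expNum a k) (m ^ M) (p ^ k) ⟩
  m ^ M * (expNum a k * p ^ k)      ≤⟨ *-monoʳ-≤ (m ^ M) (expNum≤negBinNum p a k) ⟩
  m ^ M * negBinNum p M k           ≤⟨ negBinNum-bound m M k ⟩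
  p ^ M * (k ! * p ^ k)             ≡⟨ *-assoc (p ^ M) (k !) (p ^ k) ⟨
  p ^ M * k ! * p ^ k               ∎)
  where
  open ≤-Reasoning
  p = suc m
  M = p * a
  regroup : ∀ e x q → e * x * q ≡ x * (e * q)
  regroup = solve-∀

^-ratio-mono : ∀ {m p x y} → m ≤ p → x ≤ y → p ^ x * m ^ y ≤ p ^ y * m ^ x
^-ratio-mono {m} {p} {x} {y} m≤p x≤y = begin
  p ^ x * m ^ y               ≡⟨ cong (λ z → p ^ x * m ^ z) y≡x+d ⟩
  p ^ x * m ^ (x + d)         ≡⟨ cong (p ^ x *_) (^-distribˡ-+-* m x d) ⟩
  p ^ x * (m ^ x * m ^ d)     ≤⟨ *-monoʳ-≤ (p ^ x) (*-monoʳ-≤ (m ^ x) (^-monoˡ-≤ d m≤p)) ⟩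
  p ^ x * (m ^ x * p ^ d)     ≡⟨ regroup (p ^ x) (m ^ x) (p ^ d) ⟩
  p ^ x * p ^ d * m ^ x       ≡⟨ cong (_* m ^ x) (^-distribˡ-+-* p x d) ⟨
  p ^ (x + d) * m ^ x         ≡⟨ cong (λ z → p ^ z * m ^ x) y≡x+d ⟨
  p ^ y * m ^ x               ∎
  where
  open ≤-Reasoning
  d = y ∸ x
  y≡x+d : y ≡ x + d
  y≡x+d = sym (m+[n∸m]≡n x≤y)
  regroup : ∀ u v w → u * (v * w) ≡ u * w * v
  regroup = solve-∀

-- e^a ≤ (p/m)^(pa) ≤ (p/m)^(pcL) ≤ n^(cp).
exp≤power : ∀ m L c n a .{{_ : NonZero m}} → suc m ^ L ≤ n * m ^ L → a ≤ c * L →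
            ∀ k → expNum a k ≤ n ^ (c * suc m) * k !
exp≤power m L c n a p^L≤n*m^L a≤cL k = *-cancelʳ-≤ _ _ (m ^ M * m ^ Y) {{m*n≢0 (m ^ M) (m ^ Y)}} (begin
  expNum a k * (m ^ M * m ^ Y)        ≡⟨ *-assoc (expNum a k) (m ^ M) (m ^ Y) ⟨
  expNum a k * m ^ M * m ^ Y          ≤⟨ *-monoˡ-≤ (m ^ Y) (exp≤negBinomial m a k) ⟩
  p ^ M * k ! * m ^ Y                 ≡⟨ regroup (p ^ M) (k !) (m ^ Y) ⟩
  k ! * (p ^ M * m ^ Y)               ≤⟨ *-monoʳ-≤ (k !) (^-ratio-mono (n≤1+n m) M≤Y) ⟩
  k ! * (p ^ Y * m ^ M)               ≤⟨ *-monoʳ-≤ (k !) (*-monoˡ-≤ (m ^ M) p^Y≤) ⟩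
  k ! * (n ^ (c * p) * m ^ Y * m ^ M) ≡⟨ regroup′ (k !) (n ^ (c * p)) (m ^ Y) (m ^ M) ⟩
  n ^ (c * p) * k ! * (m ^ M * m ^ Y) ∎)
  where
  open ≤-Reasoning
  p = suc m
  M = p * a
  Y = L * (c * p)
  instance
    m^M≢0 : NonZero (m ^ M)
    m^M≢0 = m^n≢0 m M
    m^Y≢0 : NonZero (m ^ Y)
    m^Y≢0 = m^n≢0 m Y
  M≤Y : M ≤ Y
  M≤Y = ≤-trans (*-monoʳ-≤ p a≤cL) (≤-reflexive (swap p c L))
    where
    swap : ∀ p c L → p * (c * L) ≡ L * (c * p)
    swap = solve-∀
  p^Y≤ : p ^ Y ≤ n ^ (c * p) * m ^ Y
  p^Y≤ = begin
    p ^ Y                       ≡⟨ ^-*-assoc p L (c * p) ⟨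
    (p ^ L) ^ (c * p)           ≤⟨ ^-monoˡ-≤ (c * p) p^L≤n*m^L ⟩
    (n * m ^ L) ^ (c * p)       ≡⟨ ^-distribʳ-* n (m ^ L) (c * p) ⟩
    n ^ (c * p) * (m ^ L) ^ (c * p) ≡⟨ cong (n ^ (c * p) *_) (^-*-assoc m L (c * p)) ⟩
    n ^ (c * p) * m ^ Y         ∎
  regroup : ∀ x f y → x * f * y ≡ f * (x * y)
  regroup = solve-∀
  regroup′ : ∀ f N y x → f * (N * y * x) ≡ N * f * (x * y)
  regroup′ = solve-∀

toℚᵘ-/ : ∀ n d .{{_ : NonZero d}} → toℚᵘ (ℤ.+ n ℚ./ d) ≃ᵘ ℤ.+ n /ᵘ d
toℚᵘ-/ n (suc d) = toℚᵘ-fromℚᵘ (mkℚᵘ (ℤ.+ n) d)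

/ᵘ-cong : ∀ {m n} d e .{{_ : NonZero d}} .{{_ : NonZero e}} → m * e ≡ n * d → ℤ.+ m /ᵘ d ≃ᵘ ℤ.+ n /ᵘ e
/ᵘ-cong {m} {n} (suc d) (suc e) eq = *≡* (trans (sym (ℤ.pos-* m (suc e))) (trans (cong ℤ.+_ eq) (ℤ.pos-* n (suc d))))

/ᵘ-mono-≤ : ∀ {m n} d e .{{_ : NonZero d}} .{{_ : NonZero e}} → m * e ≤ n * d → ℤ.+ m /ᵘ d ≤ᵘ ℤ.+ n /ᵘ e
/ᵘ-mono-≤ {m} {n} (suc d) (suc e) le = *≤* (subst₂ ℤ._≤_ (ℤ.pos-* m (suc e)) (ℤ.pos-* n (suc d)) (ℤ.+≤+ le))

/ᵘ-+ : ∀ m n d e .{{_ : NonZero d}} .{{_ : NonZero e}} →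
       ℤ.+ m /ᵘ d +ᵘ ℤ.+ n /ᵘ e ≃ᵘ (ℤ.+ (m * e + n * d) /ᵘ (d * e)) {{m*n≢0 d e}}
/ᵘ-+ m n (suc d) (suc e) = *≡* (cong (ℤ._* ℤ.+ (suc d * suc e)) (sym (begin
  ℤ.+ (m * suc e + n * suc d)               ≡⟨ ℤ.pos-+ (m * suc e) (n * suc d) ⟩
  ℤ.+ (m * suc e) ℤ.+ ℤ.+ (n * suc d)      ≡⟨ cong₂ ℤ._+_ (ℤ.pos-* m (suc e)) (ℤ.pos-* n (suc d)) ⟩
  ℤ.+ m ℤ.* ℤ.+ suc e ℤ.+ ℤ.+ n ℤ.* ℤ.+ suc d ∎)))
  where open ≡-Reasoning

expPartial≃expNum/! : ∀ a k → toℚᵘ (expPartial a k) ≃ᵘ (ℤ.+ expNum a k /ᵘ k !) {{k !≢0}}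
expPartial≃expNum/! a zero    = ℚᵘ.≃-refl
expPartial≃expNum/! a (suc k) = begin
  toℚᵘ (expPartial a k ℚ.+ expTerm a (suc k))             ≈⟨ toℚᵘ-homo-+ (expPartial a k) (expTerm a (suc k)) ⟩
  toℚᵘ (expPartial a k) +ᵘ toℚᵘ (expTerm a (suc k))       ≈⟨ ℚᵘ.+-cong (expPartial≃expNum/! a k) (toℚᵘ-/ (a ^ suc k) (suc k !) {{suc k !≢0}}) ⟩
  ℤ.+ N /ᵘ k ! +ᵘ ℤ.+ t /ᵘ suc k !                        ≈⟨ /ᵘ-+ N t (k !) (suc k !) ⟩
  (ℤ.+ (N * suc k ! + t * k !) /ᵘ (k ! * suc k !)) {{m*n≢0 (k !) (suc k !)}}
                                                           ≈⟨ /ᵘ-cong (k ! * suc k !) (suc k !) {{m*n≢0 (k !) (suc k !)}} (regroup N t (k !) (suc k)) ⟩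
  ℤ.+ (N * suc k + t) /ᵘ suc k !                          ∎
  where
  open ℚᵘ.≃-Reasoning
  instance
    k!≢0 : NonZero (k !)
    k!≢0 = k !≢0
    sk!≢0 : NonZero (suc k !)
    sk!≢0 = suc k !≢0
  N = expNum a k
  t = a ^ suc k
  regroup : ∀ N t f k → (N * (k * f) + t * f) * (k * f) ≡ (N * k + t) * (f * (k * f))
  regroup = solve-∀

ExpLe-fromℕ : ∀ a N → (∀ k → expNum a k ≤ N * k !) → ExpLe a N
ExpLe-fromℕ a N bound k = toℚᵘ-cancel-≤ (begin
  toℚᵘ (expPartial a k)      ≃⟨ expPartial≃expNum/! a k ⟩
  ℤ.+ expNum a k /ᵘ k !      ≤⟨ /ᵘ-mono-≤ (k !) 1 (≤-trans (≤-reflexive (*-identityʳ (expNum a k))) (bound k)) ⟩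
  ℤ.+ N /ᵘ 1                 ≃⟨ toℚᵘ-/ N 1 ⟨
  toℚᵘ (ℤ.+ N ℚ./ 1)         ∎)
  where
  open ℚᵘ.≤-Reasoning
  instance
    k!≢0 : NonZero (k !)
    k!≢0 = k !≢0

expNum-zero : ∀ k → expNum 0 k ≡ k !
expNum-zero zero    = refl
expNum-zero (suc k) = begin
  expNum 0 k * suc k + 0   ≡⟨ +-identityʳ _ ⟩
  expNum 0 k * suc k       ≡⟨ cong (_* suc k) (expNum-zero k) ⟩
  k ! * suc k              ≡⟨ *-comm (k !) (suc k) ⟩
  suc k !                  ∎
  where open ≡-Reasoning

ExpLe-zero : ∀ {N} → 1 ≤ N → ExpLe 0 N
ExpLe-zero {N} 1≤N = ExpLe-fromℕ 0 N λ k → begin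
  expNum 0 k   ≡⟨ expNum-zero k ⟩
  k !          ≡⟨ *-identityˡ (k !) ⟨
  1 * k !      ≤⟨ *-monoˡ-≤ (k !) 1≤N ⟩
  N * k !      ∎
  where open ≤-Reasoning

-- A run of t rounds from u uncovered elements, each round but the last keeping at most a
-- fraction 1 − 1/p, forces (p / (p − 1))^(t − 1) ≤ u.
Decay : ℕ → ℕ → ℕ → Set
Decay p zero    u = Unit.⊤
Decay p (suc t) u = 1 ≤ p × p ^ t ≤ u * (p ∸ 1) ^ t

round-shrinks : ∀ {p u u′ c} → u′ + c ≡ u → p * u ≤ p * (p * c) → p * u′ ≤ (p ∸ 1) * u
round-shrinks {zero}               _ _ = z≤n
round-shrinks {suc m} {u} {u′} {c} u′+c≡u pu≤ppc = +-cancelʳ-≤ u (suc m * u′) (m * u) (begin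
  suc m * u′ + u          ≤⟨ +-monoʳ-≤ (suc m * u′) (*-cancelˡ-≤ (suc m) pu≤ppc) ⟩
  suc m * u′ + suc m * c  ≡⟨ *-distribˡ-+ (suc m) u′ c ⟨
  suc m * (u′ + c)        ≡⟨ cong (suc m *_) u′+c≡u ⟩
  suc m * u               ≡⟨ +-comm u (m * u) ⟩
  m * u + u               ∎)
  where open ≤-Reasoning

decay-step : ∀ {p t u u′} → 1 ≤ p → 1 ≤ u → p * u′ ≤ (p ∸ 1) * u → Decay p t u′ → Decay p (suc t) u
decay-step {t = zero}  {u} 1≤p 1≤u _ _ = 1≤p , ≤-trans 1≤u (≤-reflexive (sym (*-identityʳ u)))
decay-step {p} {suc t} {u} {u′} 1≤p _ pu′≤qu (_ , p^t≤u′q^t) = 1≤p , (begin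
  p * p ^ t               ≤⟨ *-monoʳ-≤ p p^t≤u′q^t ⟩
  p * (u′ * q ^ t)        ≡⟨ *-assoc p u′ (q ^ t) ⟨
  p * u′ * q ^ t          ≤⟨ *-monoˡ-≤ (q ^ t) pu′≤qu ⟩
  q * u * q ^ t           ≡⟨ regroup q u (q ^ t) ⟩
  u * (q * q ^ t)         ∎)
  where
  open ≤-Reasoning
  q = p ∸ 1
  regroup : ∀ q u r → q * u * r ≡ u * (q * r)
  regroup = solve-∀

decay⇒ExpLe : ∀ p t n → Decay p t n → 1 ≤ n ^ (2 * p) → ExpLe (2 * t ∸ 2 * p) (n ^ (2 * p))
decay⇒ExpLe p zero n _ 1≤N rewrite 0∸n≡0 (2 * p) = ExpLe-zero 1≤N
decay⇒ExpLe (suc zero) (suc zero) n _ 1≤N = ExpLe-zero 1≤N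
decay⇒ExpLe (suc zero) (suc (suc t)) n (_ , 1≤n*0) =
  contradiction (subst₂ _≤_ (^-zeroˡ (suc t)) (*-zeroʳ n) 1≤n*0) λ ()
decay⇒ExpLe (suc (suc m)) (suc t) n (_ , p^t≤n*m^t) _ =
  ExpLe-fromℕ a (n ^ (2 * suc (suc m))) (exp≤power (suc m) t 2 n a p^t≤n*m^t a≤2t)
  where
  a = 2 * suc t ∸ 2 * suc (suc m)
  a≤2t : a ≤ 2 * t
  a≤2t = ≤-trans (∸-monoʳ-≤ (2 * suc t) (*-monoʳ-≤ 2 (s≤s (z≤n {suc m}))))
                 (≤-reflexive (cong (_∸ 2) (*-suc 2 t)))

∈group⁺ : ∀ {s k} {col : Fin s → Fin k} {i h} → col i ≡ h → i ∈ group col h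
∈group⁺ {col = col} {i} refl = lookup⇒[]= i _ (begin
  lookup (group col (col i)) i   ≡⟨ lookup∘tabulate (λ j → isYes (col j Fin.≟ col i)) i ⟩
  isYes (col i Fin.≟ col i)      ≡⟨ isYes≗does (col i Fin.≟ col i) ⟩
  does (col i Fin.≟ col i)       ≡⟨ dec-true (col i Fin.≟ col i) refl ⟩
  true                           ∎)
  where open ≡-Reasoning

∈group⁻ : ∀ {s k} {col : Fin s → Fin k} {i h} → i ∈ group col h → col i ≡ h
∈group⁻ {col = col} {i} {h} i∈group with col i Fin.≟ h | trans (sym (lookup∘tabulate _ i)) ([]=⇒lookup i∈group)
... | yes col[i]≡h | _ = col[i]≡h
... | no  _        | ()

x∈p⇒1≤∣p∣ : ∀ {n} {x : Fin n} {p} → x ∈ p → 1 ≤ ∣ p ∣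
x∈p⇒1≤∣p∣ x∈p = ≤-<-trans z≤n (x∈p⇒∣p-x∣<∣p∣ x∈p)

x∈p─q⇒x∉q : ∀ {n} {x : Fin n} p q → x ∈ p ─ q → x ∉ q
x∈p─q⇒x∉q (_ ∷ p) (inside  ∷ q) (there x∈p─q) (there x∈q) = x∈p─q⇒x∉q p q x∈p─q x∈q
x∈p─q⇒x∉q (_ ∷ p) (outside ∷ q) (there x∈p─q) (there x∈q) = x∈p─q⇒x∉q p q x∈p─q x∈q
x∈p─q⇒x∉q (_ ∷ p) (outside ∷ q) here          ()

∩∪-mono : ∀ {n} {r p q p′ q′ : Subset n} → r ∩ p ⊆ p′ → r ∩ q ⊆ q′ → r ∩ (p ∪ q) ⊆ r ∩ (p′ ∪ q′)
∩∪-mono {r = r} {p} {q} rp⊆p′ rq⊆q′ x∈ with x∈p∩q⁻ r (p ∪ q) x∈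
... | x∈r , x∈p∪q with x∈p∪q⁻ p q x∈p∪q
...   | inj₁ x∈p = x∈p∩q⁺ (x∈r , x∈p∪q⁺ (inj₁ (rp⊆p′ (x∈p∩q⁺ (x∈r , x∈p)))))
...   | inj₂ x∈q = x∈p∩q⁺ (x∈r , x∈p∪q⁺ (inj₂ (rq⊆q′ (x∈p∩q⁺ (x∈r , x∈q)))))

module _ {n s : ℕ} (S : Fin s → Subset n) (col : Fin s → Fin 2) where

  Uncovered : Subset s → Subset n → Set
  Uncovered X U = ∀ {x u} → x ∈ X → u ∈ U → u ∉ S x

  Uncovered-⊥ : ∀ {U} → Uncovered ⊥ U
  Uncovered-⊥ x∈⊥ = contradiction x∈⊥ ∉⊥

  Uncovered-step : ∀ {X U a b} → Uncovered X U → Uncovered ((X ∪ ⁅ a ⁆) ∪ ⁅ b ⁆) (U ─ (S a ∪ S b))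
  Uncovered-step {X} {U} {a} {b} uncovered x∈X′ u∈U′ u∈Sx
    with x∈p∪q⁻ (X ∪ ⁅ a ⁆) ⁅ b ⁆ x∈X′
  ... | inj₂ x∈⁅b⁆ rewrite x∈⁅y⁆⇒x≡y b x∈⁅b⁆ = u∉W (x∈p∪q⁺ (inj₂ u∈Sx))
    where u∉W = x∈p─q⇒x∉q U (S a ∪ S b) u∈U′
  ... | inj₁ x∈X∪⁅a⁆ with x∈p∪q⁻ X ⁅ a ⁆ x∈X∪⁅a⁆
  ...   | inj₁ x∈X = uncovered x∈X (p─q⊆p U (S a ∪ S b) u∈U′) u∈Sx
  ...   | inj₂ x∈⁅a⁆ rewrite x∈⁅y⁆⇒x≡y a x∈⁅a⁆ = x∈p─q⇒x∉q U (S a ∪ S b) u∈U′ (x∈p∪q⁺ (inj₁ u∈Sx))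

  replace : ∀ {X U x} A → Uncovered X U → x ∉ X → col x ≡ col A →
            ∃ λ A′ → A′ ∉ X × col A′ ≡ col A × U ∩ S A ⊆ S A′
  replace {X} {U} {x} A uncovered x∉X col[x]≡col[A] with A ∈? X
  ... | no  A∉X = A , A∉X , refl , λ u∈ → proj₂ (x∈p∩q⁻ U (S A) u∈)
  ... | yes A∈X = x , x∉X , col[x]≡col[A] , λ u∈ →
    let u∈U , u∈SA = x∈p∩q⁻ U (S A) u∈ in contradiction u∈SA (uncovered A∈X u∈U)

  MaximalPair : Subset s → Subset n → Fin s → Fin s → Set
  MaximalPair X U a b = ∀ a′ b′ → a′ ∉ X → b′ ∉ X → col a′ ≡ g₁ → col b′ ≡ g₂ →
                        ∣ U ∩ (S a′ ∪ S b′) ∣ ≤ ∣ U ∩ (S a ∪ S b) ∣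

  maximal-pair-dominates : ∀ {X U a b A B} → Uncovered X U → a ∉ X → b ∉ X → col a ≡ g₁ → col b ≡ g₂ →
    MaximalPair X U a b → col A ≡ g₁ → col B ≡ g₂ → ∣ U ∩ (S A ∪ S B) ∣ ≤ ∣ U ∩ (S a ∪ S b) ∣
  maximal-pair-dominates {A = A} {B} uncovered a∉X b∉X col[a] col[b] maximal col[A] col[B] =
    let A′ , A′∉X , col[A′] , UA⊆SA′ = replace A uncovered a∉X (trans col[a] (sym col[A]))
        B′ , B′∉X , col[B′] , UB⊆SB′ = replace B uncovered b∉X (trans col[b] (sym col[B]))
    in ≤-trans (p⊆q⇒∣p∣≤∣q∣ (∩∪-mono UA⊆SA′ UB⊆SB′))
               (maximal A′ B′ A′∉X B′∉X (trans col[A′] col[A]) (trans col[B′] col[B]))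

  module _ (Xstar : Subset s) (cover : IsCover S Xstar)
           (balanced : ∣ Xstar ∩ group col g₂ ∣ ≡ ∣ Xstar ∩ group col g₁ ∣) where

    F₁ F₂ : Subset s
    F₁ = Xstar ∩ group col g₁
    F₂ = Xstar ∩ group col g₂

    classify : ∀ {C} → C ∈ Xstar → C ∈ F₁ ⊎ C ∈ F₂
    classify {C} C∈Xstar with col C in col[C]
    ... | zero     = inj₁ (x∈p∩q⁺ (C∈Xstar , ∈group⁺ col[C]))
    ... | suc zero = inj₂ (x∈p∩q⁺ (C∈Xstar , ∈group⁺ col[C]))

    covered : ∀ u → ∃ λ C → (C ∈ F₁ ⊎ C ∈ F₂) × u ∈ S C
    covered u with cover u
    ... | C , C∈Xstar , u∈SC = C , classify C∈Xstar , u∈SC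

    1≤∣F₁∣ : Fin n → 1 ≤ ∣ F₁ ∣
    1≤∣F₁∣ u with covered u
    ... | _ , inj₁ C∈F₁ , _ = x∈p⇒1≤∣p∣ C∈F₁
    ... | _ , inj₂ C∈F₂ , _ = subst (1 ≤_) balanced (x∈p⇒1≤∣p∣ C∈F₂)

    greedy-round : ∀ {X U a b} → Uncovered X U → a ∉ X → b ∉ X → col a ≡ g₁ → col b ≡ g₂ →
                   MaximalPair X U a b → ∣ F₁ ∣ * ∣ U ─ (S a ∪ S b) ∣ ≤ (∣ F₁ ∣ ∸ 1) * ∣ U ∣
    greedy-round {U = U} {a} {b} uncovered a∉X b∉X col[a] col[b] maximal =
      round-shrinks {p} (∣p─q∣+∣p∩q∣≡∣p∣ U (S a ∪ S b)) (begin
        p * ∣ U ∣                  ≡⟨ *-comm p ∣ U ∣ ⟩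
        ∣ U ∣ * p                  ≡⟨ cong (∣ U ∣ *_) (⊓-idem p) ⟨
        ∣ U ∣ * (p ⊓ p)            ≡⟨ cong (λ q → ∣ U ∣ * (p ⊓ q)) balanced ⟨
        ∣ U ∣ * (p ⊓ ∣ F₂ ∣)       ≤⟨ pair-averaging S F₁ F₂ U c (λ {u} _ → covered u) dominated ⟩
        p * (∣ F₂ ∣ * c)           ≡⟨ cong (λ q → p * (q * c)) balanced ⟩
        p * (p * c)                ∎)
      where
      open ≤-Reasoning
      p = ∣ F₁ ∣
      c = ∣ U ∩ (S a ∪ S b) ∣
      dominated : ∀ {A B} → A ∈ F₁ → B ∈ F₂ → ∣ U ∩ (S A ∪ S B) ∣ ≤ c
      dominated A∈F₁ B∈F₂ = maximal-pair-dominates uncovered a∉X b∉X col[a] col[b] maximal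
        (∈group⁻ (proj₂ (x∈p∩q⁻ Xstar _ A∈F₁))) (∈group⁻ (proj₂ (x∈p∩q⁻ Xstar _ B∈F₂)))

    greedy-run : ∀ {X U X′} → GreedyRun S col X U X′ → Uncovered X U →
                 ∃ λ t → ∣ X′ ∣ ≡ 2 * t + ∣ X ∣ × Decay (∣ F₁ ∣) t (∣ U ∣)
    greedy-run (done _) _ = 0 , refl , tt
    greedy-run {X} {X′ = X′} (step a b (u , u∈U) a∉X b∉X col[a] col[b] maximal rest) uncovered
      with greedy-run rest (Uncovered-step uncovered)
    ... | t , ∣X′∣≡2t+∣X₂∣ , decay =
      suc t , ∣X′∣≡ , decay-step (1≤∣F₁∣ u) (x∈p⇒1≤∣p∣ u∈U) (greedy-round uncovered a∉X b∉X col[a] col[b] maximal) decay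
      where
      b∉X∪⁅a⁆ : b ∉ X ∪ ⁅ a ⁆
      b∉X∪⁅a⁆ b∈ with x∈p∪q⁻ X ⁅ a ⁆ b∈
      ... | inj₁ b∈X   = b∉X b∈X
      ... | inj₂ b∈⁅a⁆ with trans (sym col[a]) (trans (cong col (sym (x∈⁅y⁆⇒x≡y a b∈⁅a⁆))) col[b])
      ...   | ()
      ∣X′∣≡ : ∣ X′ ∣ ≡ 2 * suc t + ∣ X ∣
      ∣X′∣≡ = begin
        ∣ X′ ∣                             ≡⟨ ∣X′∣≡2t+∣X₂∣ ⟩
        2 * t + ∣ (X ∪ ⁅ a ⁆) ∪ ⁅ b ⁆ ∣     ≡⟨ cong (2 * t +_) (x∉p⇒∣p∪⁅x⁆∣≡1+∣p∣ b∉X∪⁅a⁆) ⟩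
        2 * t + suc ∣ X ∪ ⁅ a ⁆ ∣           ≡⟨ cong (λ x → 2 * t + suc x) (x∉p⇒∣p∪⁅x⁆∣≡1+∣p∣ a∉X) ⟩
        2 * t + suc (suc ∣ X ∣)             ≡⟨ regroup t ∣ X ∣ ⟩
        2 * suc t + ∣ X ∣                   ∎
        where
        open ≡-Reasoning
        regroup : ∀ t x → 2 * t + suc (suc x) ≡ 2 * suc t + x
        regroup = solve-∀

⊥-isFair : ∀ {s k} (col : Fin s → Fin k) → IsFair col ⊥
⊥-isFair {s} {k} col h = begin
  k * ∣ ⊥ ∩ group col h ∣   ≡⟨ cong (λ x → k * ∣ x ∣) (∩-zeroˡ (group col h)) ⟩
  k * ∣ ⊥ {s} ∣             ≡⟨ cong (k *_) (∣⊥∣≡0 s) ⟩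
  k * 0                     ≡⟨ *-zeroʳ k ⟩
  0                         ≡⟨ ∣⊥∣≡0 s ⟨
  ∣ ⊥ {s} ∣                 ∎
  where open ≡-Reasoning

-- Minimality is used only here: for n = 0 the bound n ^ ∣X*∣ ≥ 1 needs X* = ∅.
1≤n^∣Xstar∣ : ∀ {n s} {S : Fin s → Subset n} {col : Fin s → Fin 2} {Xstar} →
              IsMinFairCover S col Xstar → 1 ≤ n ^ ∣ Xstar ∣
1≤n^∣Xstar∣ {zero} {s} {col = col} {Xstar} (_ , _ , minimal)
  rewrite n≤0⇒n≡0 (subst (∣ Xstar ∣ ≤_) (∣⊥∣≡0 s) (minimal ⊥ (λ ()) (⊥-isFair col))) = ≤-refl
1≤n^∣Xstar∣ {suc n} {Xstar = Xstar} _ = m^n>0 (suc n) ∣ Xstar ∣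

lemma4p2 : ∀ (n s : ℕ) (S : Fin s → Subset n) (col : Fin s → Fin 2) →
    FamilyCoversU S →
    EqualGroupSizes col →
    ∀ (Xstar : Subset s) → IsMinFairCover S col Xstar →
    ∀ (X : Subset s) → GreedyRun S col ⊥ ⊤ X →
    LnBound ∣ X ∣ ∣ Xstar ∣ n
lemma4p2 n s S col _ _ Xstar optimal@(cover , fair , _) X run =
  let t , ∣X∣≡2t+∣⊥∣ , decay = greedy-run S col Xstar cover balanced run (Uncovered-⊥ S col)
      ∣X∣≡2t = trans ∣X∣≡2t+∣⊥∣ (trans (cong (2 * t +_) (∣⊥∣≡0 s)) (+-identityʳ (2 * t)))
  in subst₂ (λ x y → LnBound x y n) (sym ∣X∣≡2t) (fair g₁)
       (decay⇒ExpLe _ t n (subst (Decay _ t) (∣⊤∣≡n n) decay)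
                    (subst (λ x → 1 ≤ n ^ x) (sym (fair g₁)) (1≤n^∣Xstar∣ optimal)))
  where
  balanced : ∣ Xstar ∩ group col g₂ ∣ ≡ ∣ Xstar ∩ group col g₁ ∣
  balanced = *-cancelˡ-≡ _ _ 2 (trans (fair g₂) (sym (fair g₁)))
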